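{- Let $n\ge 1$. If $\mathcal{P}$ is an ideal path system of $C_{2n+1}$, then $\mathcal{P}$ is perfect, i.e., every path in $\mathcal{P}$ is a shortest path between its endpoints.
   Context: $C_m$ denotes the cycle with vertices $0,1,\dots,m-1$ and edges $\{i,i+1 \bmod m\}$. For a connected graph $G$, a path system of $G$ is a set consisting of one chosen path in $G$ connecting $a$ and $b$ for each unordered pair $\{a,b\}$ of distinct vertices. A global packing of $(G,\mathcal{P})$ is a map $\omega:\mathcal{P}\to\{1,\dots,k\}$ such that $\omega(P)\neq\omega(P')$ whenever distinct paths $P,P'\in\mathcal{P}$ share at least one edge; $\Phi(G,\mathcal{P})$ is the minimum such $k$, and $\Phi(G)$ is the minimum of $\Phi(G,\mathcal{P})$ over all path systems of $G$. A path system $\mathcal{P}$ is ideal if $\Phi(G,\mathcal{P})=\Phi(G)$; it is perfect if it is ideal and each of its paths is a shortest path between its endpoints. -}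

module Defs where

open import Data.Nat using (ℕ; zero; suc; _+_; _*_; _∸_; _≤_)
open import Data.Fin using (Fin; toℕ; _<_)
open import Data.List using (List; []; _∷_; length)
open import Data.List.Relation.Unary.Unique.Propositional using (Unique)
open import Data.Product using (Σ; ∃; _×_; _,_; proj₁)
open import Data.Sum using (_⊎_)
open import Relation.Binary.PropositionalEquality using (_≡_; _≢_)

record Graph (m : ℕ) : Set₁ where
  field
    Adj : Fin m → Fin m → Set

open Graph public

-- The cycle C_m: vertices 0,…,m-1, edges {i, i+1 mod m}.
-- Step m u v  means  toℕ v ≡ (toℕ u + 1) mod m.
Step : (m : ℕ) → Fin m → Fin m → Set
Step m u v = (suc (toℕ u) ≡ toℕ v) ⊎ (suc (toℕ u) ≡ m × toℕ v ≡ 0)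

Cycle : (m : ℕ) → Graph m
Cycle m = record { Adj = λ u v → Step m u v ⊎ Step m v u }

data Chain {m : ℕ} (G : Graph m) : Fin m → Fin m → List (Fin m) → Set where
  single : ∀ {a} → Chain G a a (a ∷ [])
  step   : ∀ {a c b vs} → Adj G a c → Chain G c b vs → Chain G a b (a ∷ vs)

Path : {m : ℕ} → Graph m → Fin m → Fin m → Set
Path G a b = Σ (List (Fin _)) λ vs → Chain G a b vs × Unique vs

len : {m : ℕ} {G : Graph m} {a b : Fin m} → Path G a b → ℕ
len p = length (proj₁ p) ∸ 1

data EdgeIn {m : ℕ} (u v : Fin m) : List (Fin m) → Set where
  here  : ∀ {vs} → EdgeIn u v (u ∷ v ∷ vs)
  there : ∀ {w vs} → EdgeIn u v vs → EdgeIn u v (w ∷ vs)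

SharesEdge : {m : ℕ} {G : Graph m} {a b c d : Fin m} →
             Path G a b → Path G c d → Set
SharesEdge {m} p q = ∃ λ (u : Fin m) → ∃ λ (v : Fin m) →
  EdgeIn u v (proj₁ p) × (EdgeIn u v (proj₁ q) ⊎ EdgeIn v u (proj₁ q))

-- A path system: one chosen path for each unordered pair {a,b} of distinct
-- vertices, represented by the pair with a < b.
PathSystem : {m : ℕ} → Graph m → Set
PathSystem {m} G = (a b : Fin m) → a < b → Path G a b

Packing : {m : ℕ} {G : Graph m} → PathSystem G → ℕ → Set
Packing {m} P k =
  Σ ((a b : Fin m) → a < b → Fin k) λ ω →
    (a b c d : Fin m) (p : a < b) (q : c < d) →
    (a ≢ c ⊎ b ≢ d) →
    SharesEdge (P a b p) (P c d q) →
    ω a b p ≢ ω c d q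

IsΦ : {m : ℕ} {G : Graph m} → PathSystem G → ℕ → Set
IsΦ P k = Packing P k × (∀ k' → Packing P k' → k ≤ k')

IsΦG : {m : ℕ} → Graph m → ℕ → Set
IsΦG G k = (Σ (PathSystem G) λ P → Packing P k) ×
           (∀ (Q : PathSystem G) k' → Packing Q k' → k ≤ k')

Ideal : {m : ℕ} {G : Graph m} → PathSystem G → Set
Ideal {G = G} P = ∃ λ k → IsΦ P k × IsΦG G k

Shortest : {m : ℕ} {G : Graph m} {a b : Fin m} → Path G a b → Set
Shortest {G = G} {a} {b} p = (q : Path G a b) → len p ≤ len q

Perfect : {m : ℕ} {G : Graph m} → PathSystem G → Set
Perfect {m} P = Ideal P × ((a b : Fin m) (p : a < b) → Shortest (P a b p))

-- The shortest paths of C_{2n+1} can be packed with n(n + 1)/2 colours: the class (i , j), for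
-- i < j ≤ n, takes the four shortest arcs cut out by i < j < i + n + 1 < j + n, which tile the cycle.
-- Hence Φ(C_{2n+1}) ≤ n(n + 1)/2.
-- A simple path of a cycle runs monotonically around it, so if P(a, b) is not a shortest path it goes
-- the long way round and has length at least n + 1. Labelling the cycle from a along P(a, b), this path
-- traverses both edges {0, 1} and {n, n + 1}, the only edges leaving the set B of vertices labelled
-- 1, …, n. Each of the n(n + 1) paths of P between B and its complement uses one of these two edges, and
-- paths through a common edge get distinct colours; counting P(a, b) once on each of the two edges gives
-- 2 + n(n + 1) ≤ 2Φ(C_{2n+1}, P), contradicting Φ(C_{2n+1}, P) = Φ(C_{2n+1}) ≤ n(n + 1)/2.

module Submission where

open import Defs
open import Data.Nat
open import Data.Nat.Properties
open import Data.Nat.Tactic.RingSolver using (solve-∀)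
open import Algebra.Properties.CommutativeSemigroup +-commutativeSemigroup
  using (xy∙z≈xz∙y; interchange)
open import Data.Fin as F using (Fin; toℕ; fromℕ<)
open import Data.Fin.Properties
  using (toℕ-injective; toℕ<n; toℕ-fromℕ<; injective⇒≤; +↔⊎; *↔×)
  renaming (_≟_ to _≟ᶠ_; <-cmp to <-cmpᶠ)
open import Data.List using (List; []; _∷_; length)
open import Data.List.Relation.Unary.All using (All; []; _∷_)
open import Data.List.Relation.Unary.AllPairs using ([]; _∷_)
open import Data.List.Relation.Unary.Unique.Propositional using (Unique)
open import Data.Product using (∃; _×_; _,_; proj₁; proj₂)
open import Data.Product.Properties using (,-injective)
open import Data.Sum using (_⊎_; inj₁; inj₂; [_,_]′; swap)
open import Data.Sum.Function.Propositional using (_⊎-↣_)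
open import Data.Empty using (⊥-elim)
open import Function using (_∘_)
open import Function.Bundles using (Injection; _↣_; mk↣)
open import Function.Properties.Inverse using (↔⇒↣)
open import Function.Construct.Composition using (_↣-∘_)
open import Function.Construct.Symmetry using (↔-sym)
open import Function.Construct.Identity using (↣-id)
open import Relation.Nullary using (¬_; yes; no; ¬?)
open import Relation.Nullary.Decidable using (_×-dec_; decidable-stable)
open import Relation.Unary using (Decidable)
open import Relation.Binary.Definitions using (tri<; tri≈; tri>)
open import Relation.Binary.PropositionalEquality

All⇒chainHead : ∀ {m} {G : Graph m} {P : Fin m → Set} {c d vs} → Chain G c d vs → All P vs → P c
All⇒chainHead single     (pc ∷ _) = pc
All⇒chainHead (step _ _) (pc ∷ _) = pc

EdgeIn-chainHead : ∀ {m} {G : Graph m} {c c' d vs} → Chain G c' d vs → EdgeIn c c' (c ∷ vs)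
EdgeIn-chainHead single     = here
EdgeIn-chainHead (step _ _) = here

distinct⇒1<m : ∀ {m} {a b : Fin m} → a ≢ b → 1 < m
distinct⇒1<m {a = F.zero}  {F.zero}  a≢b = ⊥-elim (a≢b refl)
distinct⇒1<m {a = F.suc a} {F.zero}  _   = s≤s (≤-trans (s≤s z≤n) (toℕ<n a))
distinct⇒1<m {b = F.suc b} _ = s≤s (≤-trans (s≤s z≤n) (toℕ<n b))

chain-crossing : ∀ {m} {G : Graph m} (Q : Fin m → Set) → Decidable Q → ∀ {c d vs} →
  Chain G c d vs → Q c → ¬ Q d → ∃ λ u → ∃ λ v → EdgeIn u v vs × Q u × ¬ Q v × Adj G u v
chain-crossing Q Q? single Qc ¬Qd = ⊥-elim (¬Qd Qc)
chain-crossing Q Q? {c} (step {c = c'} c~c' chain) Qc ¬Qd with Q? c'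
... | yes Qc' = let (u , v , uv∈ , rest) = chain-crossing Q Q? chain Qc' ¬Qd in u , v , there uv∈ , rest
... | no ¬Qc' = c , c' , EdgeIn-chainHead chain , Qc , ¬Qc' , c~c'

Packing-sharedEdge⇒samePair : ∀ {m} {G : Graph m} {P : PathSystem G} {k} (packing : Packing P k) →
  ∀ {c d c' d'} (c<d : c F.< d) (c'<d' : c' F.< d') → SharesEdge (P c d c<d) (P c' d' c'<d') →
  proj₁ packing c d c<d ≡ proj₁ packing c' d' c'<d' → c ≡ c' × d ≡ d'
Packing-sharedEdge⇒samePair (_ , proper) {c} {d} {c'} {d'} c<d c'<d' shared sameColour with c ≟ᶠ c' | d ≟ᶠ d'
... | yes c≡c' | yes d≡d' = c≡c' , d≡d'
... | no  c≢c' | _        = ⊥-elim (proper _ _ _ _ c<d c'<d' (inj₁ c≢c') shared sameColour)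
... | yes _    | no  d≢d' = ⊥-elim (proper _ _ _ _ c<d c'<d' (inj₂ d≢d') shared sameColour)

sortPair : ∀ {m} (x y : Fin m) → x ≢ y →
  ∃ λ c → ∃ λ d → c F.< d × ((c ≡ x × d ≡ y) ⊎ (c ≡ y × d ≡ x))
sortPair x y x≢y with <-cmpᶠ x y
... | tri< x<y _ _ = x , y , x<y , inj₁ (refl , refl)
... | tri≈ _ x≡y _ = ⊥-elim (x≢y x≡y)
... | tri> _ _ y<x = y , x , y<x , inj₂ (refl , refl)

triangle : ℕ → ℕ
triangle zero    = 0
triangle (suc j) = suc j + triangle j

triangle-double : ∀ j → triangle j + triangle j ≡ j * suc j
triangle-double zero    = refl
triangle-double (suc j) = begin
  (suc j + triangle j) + (suc j + triangle j) ≡⟨ interchange (suc j) (triangle j) (suc j) (triangle j) ⟩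
  (suc j + suc j) + (triangle j + triangle j) ≡⟨ cong ((suc j + suc j) +_) (triangle-double j) ⟩
  (suc j + suc j) + j * suc j                 ≡⟨ expand j ⟩
  suc j * suc (suc j)                         ∎
  where
  open ≡-Reasoning
  expand : ∀ j → (suc j + suc j) + j * suc j ≡ suc j * suc (suc j)
  expand = solve-∀

triangle-mono-≤ : ∀ {i j} → i ≤ j → triangle i ≤ triangle j
triangle-mono-≤ {zero}              _         = z≤n
triangle-mono-≤ {suc i} {suc j} (s≤s i≤j) = +-mono-≤ (s≤s i≤j) (triangle-mono-≤ i≤j)

-- The pairs i < j ≤ n are numbered 0, 1, …, triangle n − 1, column by column.
pairCode : ℕ → ℕ → ℕ
pairCode i j = triangle (pred j) + i

pairCode<triangle : ∀ {i j n} → i < j → j ≤ n → pairCode i j < triangle n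
pairCode<triangle {i} {suc j} (s≤s i≤j) j<n = <-≤-trans below (triangle-mono-≤ j<n)
  where
  below : triangle j + i < triangle (suc j)
  below = subst (triangle j + i <_) (+-comm (triangle j) (suc j)) (+-monoʳ-< (triangle j) (s≤s i≤j))

pairCode-injective : ∀ {i j i' j'} → i < j → i' < j' → pairCode i j ≡ pairCode i' j' → i ≡ i' × j ≡ j'
pairCode-injective {i} {suc j} {i'} {suc j'} (s≤s i≤j) (s≤s i'≤j') eq with <-cmp j j'
... | tri≈ _ refl _ = +-cancelˡ-≡ (triangle j) i i' eq , refl
... | tri< j<j' _ _ = ⊥-elim (<-irrefl eq (<-≤-trans (pairCode<triangle (s≤s i≤j) j<j') (m≤m+n _ i')))
... | tri> _ _ j>j' = ⊥-elim (<-irrefl (sym eq) (<-≤-trans (pairCode<triangle (s≤s i'≤j') j>j') (m≤m+n _ i)))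

larger⇒>half : ∀ {n x y} → x + y ≡ suc (n + n) → y < x → n < x
larger⇒>half {n} {x} {y} x+y≡ y<x =
  ≰⇒> λ x≤n → <-irrefl x+y≡ (<-≤-trans (+-monoʳ-< x y<x) (≤-trans (+-mono-≤ x≤n x≤n) (n≤1+n (n + n))))

larger-of-complements : ∀ {n f g x y} → f + g ≡ suc (n + n) →
  x ≡ f ⊎ x ≡ g → y ≡ f ⊎ y ≡ g → y < x → n < x
larger-of-complements _   (inj₁ refl) (inj₁ refl) y<x = ⊥-elim (<-irrefl refl y<x)
larger-of-complements f+g (inj₁ refl) (inj₂ refl) y<x = larger⇒>half f+g y<x
larger-of-complements {f = f} {g} f+g (inj₂ refl) (inj₁ refl) y<x = larger⇒>half (trans (+-comm g f) f+g) y<x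
larger-of-complements _   (inj₂ refl) (inj₂ refl) y<x = ⊥-elim (<-irrefl refl y<x)

module CycleArithmetic (m : ℕ) where

  SuccMod : ℕ → ℕ → Set
  SuccMod x y = suc x ≡ y ⊎ (suc x ≡ m × y ≡ 0)

  AdjMod : ℕ → ℕ → Set
  AdjMod x y = SuccMod x y ⊎ SuccMod y x

  _⟶[_]_ : ℕ → ℕ → ℕ → Set
  a ⟶[ t ] v = a + t ≡ v ⊎ a + t ≡ v + m

  n+m≡o⇒o≮m : ∀ {n o} → n + m ≡ o → o ≮ m
  n+m≡o⇒o≮m {n} refl o<m = n≮n m (≤-<-trans (m≤n+m m n) o<m)

  ⟶-offset-unique : ∀ {a v t t'} → t < m → t' < m → a ⟶[ t ] v → a ⟶[ t' ] v → t ≡ t'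
  ⟶-offset-unique {a} _ _ (inj₁ e) (inj₁ e') = +-cancelˡ-≡ a _ _ (trans e (sym e'))
  ⟶-offset-unique {a} {t = t} _ t'<m (inj₁ e) (inj₂ e') =
    ⊥-elim (n+m≡o⇒o≮m (+-cancelˡ-≡ a _ _ (trans (sym (+-assoc a t m)) (trans (cong (_+ m) e) (sym e')))) t'<m)
  ⟶-offset-unique {a} {t' = t'} t<m _ (inj₂ e) (inj₁ e') =
    ⊥-elim (n+m≡o⇒o≮m (+-cancelˡ-≡ a _ _ (trans (sym (+-assoc a t' m)) (trans (cong (_+ m) e') (sym e)))) t<m)
  ⟶-offset-unique {a} _ _ (inj₂ e) (inj₂ e') = +-cancelˡ-≡ a _ _ (trans e (sym e'))

  ⟶-target-unique : ∀ {a t u v} → u < m → v < m → a ⟶[ t ] u → a ⟶[ t ] v → u ≡ v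
  ⟶-target-unique _ _ (inj₁ e) (inj₁ e') = trans (sym e) e'
  ⟶-target-unique u<m _ (inj₁ e) (inj₂ e') = ⊥-elim (n+m≡o⇒o≮m (trans (sym e') e) u<m)
  ⟶-target-unique _ v<m (inj₂ e) (inj₁ e') = ⊥-elim (n+m≡o⇒o≮m (trans (sym e) e') v<m)
  ⟶-target-unique {u = u} {v} _ _ (inj₂ e) (inj₂ e') = +-cancelʳ-≡ m u v (trans (sym e) e')

  ⟶-source-unique : ∀ {a b t v} → a < m → b < m → a ⟶[ t ] v → b ⟶[ t ] v → a ≡ b
  ⟶-source-unique {a} {b} {t} _ _ (inj₁ e) (inj₁ e') = +-cancelʳ-≡ t a b (trans e (sym e'))
  ⟶-source-unique {a} {b} {t} _ b<m (inj₁ e) (inj₂ e') =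
    ⊥-elim (n+m≡o⇒o≮m (+-cancelʳ-≡ t _ _ (trans (xy∙z≈xz∙y a m t) (trans (cong (_+ m) e) (sym e')))) b<m)
  ⟶-source-unique {a} {b} {t} a<m _ (inj₂ e) (inj₁ e') =
    ⊥-elim (n+m≡o⇒o≮m (+-cancelʳ-≡ t _ _ (trans (xy∙z≈xz∙y b m t) (trans (cong (_+ m) e') (sym e)))) a<m)
  ⟶-source-unique {a} {b} {t} _ _ (inj₂ e) (inj₂ e') = +-cancelʳ-≡ t a b (trans e (sym e'))

  offset : ℕ → ℕ → ℕ
  offset a v with a ≤? v
  ... | yes _ = v ∸ a
  ... | no  _ = v + m ∸ a

  offset-⟶ : ∀ {a v} → a < m → a ⟶[ offset a v ] v
  offset-⟶ {a} {v} a<m with a ≤? v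
  ... | yes a≤v = inj₁ (m+[n∸m]≡n a≤v)
  ... | no  _   = inj₂ (m+[n∸m]≡n (≤-trans (<⇒≤ a<m) (m≤n+m m v)))

  offset<m : ∀ {a v} → a < m → v < m → offset a v < m
  offset<m {a} {v} a<m v<m with a ≤? v
  ... | yes _   = ≤-<-trans (m∸n≤m v a) v<m
  ... | no  a≰v = +-cancelˡ-< a _ _ (subst (_< a + m) (sym (m+[n∸m]≡n a≤v+m)) (+-monoˡ-< m (≰⇒> a≰v)))
    where a≤v+m = ≤-trans (<⇒≤ a<m) (m≤n+m m v)

  ⟶⇒offset : ∀ {a v t} → a < m → v < m → t < m → a ⟶[ t ] v → offset a v ≡ t
  ⟶⇒offset a<m v<m t<m = ⟶-offset-unique (offset<m a<m v<m) t<m (offset-⟶ a<m)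

  offset-self : ∀ a → offset a a ≡ 0
  offset-self a with a ≤? a
  ... | yes _   = n∸n≡0 a
  ... | no  a≰a = ⊥-elim (a≰a ≤-refl)

  private
    ∸+∸≡m : ∀ {x y} → x ≤ y → y ≤ x + m → (y ∸ x) + (x + m ∸ y) ≡ m
    ∸+∸≡m {x} {y} x≤y y≤x+m = +-cancelˡ-≡ x _ _ (begin
      x + ((y ∸ x) + (x + m ∸ y)) ≡⟨ +-assoc x _ _ ⟨
      (x + (y ∸ x)) + (x + m ∸ y) ≡⟨ cong (_+ (x + m ∸ y)) (m+[n∸m]≡n x≤y) ⟩
      y + (x + m ∸ y)             ≡⟨ m+[n∸m]≡n y≤x+m ⟩
      x + m                       ∎)
      where open ≡-Reasoning

  offset+offset≡m : ∀ {a b} → a < m → b < m → a ≢ b → offset a b + offset b a ≡ m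
  offset+offset≡m {a} {b} a<m b<m a≢b with a ≤? b | b ≤? a
  ... | yes a≤b | yes b≤a = ⊥-elim (a≢b (≤-antisym a≤b b≤a))
  ... | yes a≤b | no  _   = ∸+∸≡m a≤b (≤-trans (<⇒≤ b<m) (m≤n+m m a))
  ... | no  _   | yes b≤a = trans (+-comm (b + m ∸ a) (a ∸ b)) (∸+∸≡m b≤a (≤-trans (<⇒≤ a<m) (m≤n+m m b)))
  ... | no  a≰b | no  b≰a = ⊥-elim ([ a≰b , b≰a ]′ (≤-total a b))

  offset-injectiveʳ : ∀ {a u v} → a < m → u < m → v < m → offset a u ≡ offset a v → u ≡ v
  offset-injectiveʳ {a} {u} a<m u<m v<m eq =
    ⟶-target-unique {a} u<m v<m (subst (a ⟶[_] u) eq (offset-⟶ a<m)) (offset-⟶ a<m)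

  offset-injectiveˡ : ∀ {a u v} → u < m → v < m → offset u a ≡ offset v a → u ≡ v
  offset-injectiveˡ {a} {u} {v} u<m v<m eq =
    ⟶-source-unique u<m v<m (subst (u ⟶[_] a) eq (offset-⟶ u<m)) (offset-⟶ v<m)

  ⟶-source : ∀ {v t} → v < m → t ≤ v + m → ∃ λ u → u < m × u ⟶[ t ] v
  ⟶-source {v} {t} v<m t≤v+m with t ≤? v
  ... | yes t≤v = v ∸ t , ≤-<-trans (m∸n≤m v t) v<m , inj₁ (m∸n+n≡m t≤v)
  ... | no  t≰v = v + m ∸ t , +-cancelʳ-< t _ _ v+m<m+t , inj₂ (m∸n+n≡m t≤v+m)
    where
    v+m<m+t : v + m ∸ t + t < m + t
    v+m<m+t = subst (_< m + t) (trans (+-comm m v) (sym (m∸n+n≡m t≤v+m))) (+-monoʳ-< m (≰⇒> t≰v))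

  ⟶-target : ∀ {a t} → a < m → t < m → ∃ λ v → v < m × a ⟶[ t ] v
  ⟶-target {a} {t} a<m t<m with a + t <? m
  ... | yes a+t<m = a + t , a+t<m , inj₁ refl
  ... | no  a+t≮m = a + t ∸ m , +-cancelʳ-< m _ _ a+t<m+m , inj₂ (sym (m∸n+n≡m (≮⇒≥ a+t≮m)))
    where
    a+t<m+m : a + t ∸ m + m < m + m
    a+t<m+m = subst (_< m + m) (sym (m∸n+n≡m (≮⇒≥ a+t≮m))) (+-mono-< a<m t<m)

  offset-surjectiveʳ : ∀ {a t} → a < m → t < m → ∃ λ v → v < m × offset a v ≡ t
  offset-surjectiveʳ a<m t<m with ⟶-target a<m t<m
  ... | v , v<m , a⟶v = v , v<m , ⟶⇒offset a<m v<m t<m a⟶v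

  offset-surjectiveˡ : ∀ {a t} → a < m → t < m → ∃ λ u → u < m × offset u a ≡ t
  offset-surjectiveˡ {a} a<m t<m with ⟶-source a<m (≤-trans (<⇒≤ t<m) (m≤n+m m a))
  ... | u , u<m , u⟶a = u , u<m , ⟶⇒offset u<m a<m t<m u⟶a

  succMod : ℕ → ℕ
  succMod x with suc x ≟ m
  ... | yes _ = 0
  ... | no  _ = suc x

  SuccMod-succMod : ∀ x → SuccMod x (succMod x)
  SuccMod-succMod x with suc x ≟ m
  ... | yes x+1≡m = inj₂ (x+1≡m , refl)
  ... | no  _     = inj₁ refl

  succMod<m : ∀ {x} → x < m → succMod x < m
  succMod<m {x} x<m with suc x ≟ m
  ... | yes refl  = z<s
  ... | no  x+1≢m = ≤∧≢⇒< x<m x+1≢m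

  SuccMod-functional : ∀ {x y z} → y < m → z < m → SuccMod x y → SuccMod x z → y ≡ z
  SuccMod-functional _   _   (inj₁ e)       (inj₁ e')       = trans (sym e) e'
  SuccMod-functional y<m _   (inj₁ e)       (inj₂ (e' , _)) = ⊥-elim (n≮n m (subst (_< m) (trans (sym e) e') y<m))
  SuccMod-functional _   z<m (inj₂ (e , _)) (inj₁ e')       = ⊥-elim (n≮n m (subst (_< m) (trans (sym e') e) z<m))
  SuccMod-functional _   _   (inj₂ (_ , e)) (inj₂ (_ , e')) = trans e (sym e')

  SuccMod-injective : ∀ {x y z} → SuccMod x z → SuccMod y z → x ≡ y
  SuccMod-injective (inj₁ e)       (inj₁ e')       = suc-injective (trans e (sym e'))
  SuccMod-injective (inj₁ e)       (inj₂ (_ , e')) = ⊥-elim (0≢1+n (sym (trans e e')))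
  SuccMod-injective (inj₂ (_ , e)) (inj₁ e')       = ⊥-elim (0≢1+n (sym (trans e' e)))
  SuccMod-injective (inj₂ (e , _)) (inj₂ (e' , _)) = suc-injective (trans e (sym e'))

  SuccMod-asym : ∀ {x y} → 2 < m → SuccMod x y → ¬ SuccMod y x
  SuccMod-asym {x} _ (inj₁ refl)       (inj₁ e)          = <-irrefl (sym e) (<-trans (n<1+n x) (n<1+n (suc x)))
  SuccMod-asym 2<m  (inj₁ refl)       (inj₂ (e , refl)) = <-irrefl e 2<m
  SuccMod-asym 2<m  (inj₂ (e , refl)) (inj₁ refl)       = <-irrefl e 2<m
  SuccMod-asym 2<m  (inj₂ (e , refl)) (inj₂ (_ , refl)) = <-irrefl e (<-trans (n<1+n 1) 2<m)

  ⟶-reduce : ∀ {x t y} → y < m → x ⟶[ suc t ] y → x ⟶[ succMod t ] y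
  ⟶-reduce {x} {t} {y} y<m x⟶y with suc t ≟ m | x⟶y
  ... | no  _    | _      = x⟶y
  ... | yes refl | inj₁ e = ⊥-elim (n+m≡o⇒o≮m e y<m)
  ... | yes refl | inj₂ e = inj₁ (trans (+-identityʳ x) (+-cancelʳ-≡ (suc t) x y e))

  ⟶-succʳ : ∀ {a t u v} → a < m → t < m → a ⟶[ t ] u → SuccMod u v → a ⟶[ suc t ] v
  ⟶-succʳ {a} {t} a<m t<m a⟶u u→v with a⟶u | u→v
  ... | inj₁ e | inj₁ e'          = inj₁ (trans (+-suc a t) (trans (cong suc e) e'))
  ... | inj₂ e | inj₁ e'          = inj₂ (trans (+-suc a t) (trans (cong suc e) (cong (_+ m) e')))
  ... | inj₁ e | inj₂ (e' , refl) = inj₂ (trans (+-suc a t) (trans (cong suc e) e'))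
  ... | inj₂ e | inj₂ (e' , refl) =
    ⊥-elim (<-irrefl (trans (+-suc a t) (trans (cong suc e) (cong (_+ m) e'))) (+-mono-<-≤ a<m t<m))

  ⟶-succˡ : ∀ {a s u v} → s < m → v ⟶[ s ] a → SuccMod u v → u ⟶[ suc s ] a
  ⟶-succˡ {a} {s} {u} s<m v⟶a u→v with v⟶a | u→v
  ... | inj₁ e | inj₁ e'          = inj₁ (trans (+-suc u s) (trans (cong (_+ s) e') e))
  ... | inj₂ e | inj₁ e'          = inj₂ (trans (+-suc u s) (trans (cong (_+ s) e') e))
  ... | inj₁ e | inj₂ (e' , refl) = inj₂ (trans (+-suc u s) (trans (cong (_+ s) e') (trans (cong (m +_) e) (+-comm m a))))
  ... | inj₂ e | inj₂ (_ , refl)  = ⊥-elim (n+m≡o⇒o≮m (sym e) s<m)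

  offset-succʳ : ∀ {a u v} → a < m → u < m → v < m → SuccMod u v → SuccMod (offset a u) (offset a v)
  offset-succʳ {a} {u} {v} a<m u<m v<m u→v = subst (SuccMod t) (sym offset≡) (SuccMod-succMod t)
    where
    t = offset a u
    offset≡ : offset a v ≡ succMod t
    offset≡ = ⟶⇒offset a<m v<m (succMod<m (offset<m a<m u<m))
                (⟶-reduce v<m (⟶-succʳ a<m (offset<m a<m u<m) (offset-⟶ a<m) u→v))

  offset-succˡ : ∀ {a u v} → a < m → u < m → v < m → SuccMod u v → SuccMod (offset v a) (offset u a)
  offset-succˡ {a} {u} {v} a<m u<m v<m u→v = subst (SuccMod s) (sym offset≡) (SuccMod-succMod s)
    where
    s = offset v a
    offset≡ : offset u a ≡ succMod s
    offset≡ = ⟶⇒offset u<m a<m (succMod<m (offset<m v<m a<m))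
                (⟶-reduce a<m (⟶-succˡ (offset<m v<m a<m) (offset-⟶ v<m) u→v))

  offset-succʳ⁻¹ : ∀ {a u v} → a < m → u < m → v < m → SuccMod (offset a u) (offset a v) → SuccMod u v
  offset-succʳ⁻¹ {a} {u} {v} a<m u<m v<m t→t' = subst (SuccMod u) u⁺≡v (SuccMod-succMod u)
    where
    u⁺<m = succMod<m u<m
    u⁺≡v : succMod u ≡ v
    u⁺≡v = offset-injectiveʳ a<m u⁺<m v<m
      (SuccMod-functional (offset<m a<m u⁺<m) (offset<m a<m v<m)
        (offset-succʳ a<m u<m u⁺<m (SuccMod-succMod u)) t→t')

  offset-succˡ⁻¹ : ∀ {a u v} → a < m → u < m → v < m → SuccMod (offset u a) (offset v a) → SuccMod v u
  offset-succˡ⁻¹ {a} {u} {v} a<m u<m v<m s→s' = subst (SuccMod v) v⁺≡u (SuccMod-succMod v)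
    where
    v⁺<m = succMod<m v<m
    v⁺≡u : succMod v ≡ u
    v⁺≡u = offset-injectiveˡ v⁺<m u<m
      (SuccMod-injective (offset-succˡ a<m v<m v⁺<m (SuccMod-succMod v)) s→s')

  SuccMod⇒offset≡1 : ∀ {x y} → 1 < m → x < m → y < m → SuccMod x y → offset x y ≡ 1
  SuccMod⇒offset≡1 {x} 1<m x<m y<m x→y = ⟶⇒offset x<m y<m 1<m (x⟶y x→y)
    where
    x⟶y : ∀ {y} → SuccMod x y → x ⟶[ 1 ] y
    x⟶y (inj₁ e)          = inj₁ (trans (+-comm x 1) e)
    x⟶y (inj₂ (e , refl)) = inj₂ (trans (+-comm x 1) e)

  ⟶-between : ∀ {A B U s ℓ} → A ≤ B → B < m → ℓ < m →
    A ⟶[ ℓ ] B → A ⟶[ s ] U → s < ℓ → A ≤ U × U < B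
  ⟶-between A≤B _ ℓ<m (inj₂ A+ℓ≡B+m) _ _ = ⊥-elim (<-irrefl A+ℓ≡B+m (+-mono-≤-< A≤B ℓ<m))
  ⟶-between {A} {s = s} _ _ _ (inj₁ refl) (inj₁ refl) s<ℓ = m≤m+n A s , +-monoʳ-< A s<ℓ
  ⟶-between {A} {U = U} _ B<m _ (inj₁ refl) (inj₂ A+s≡U+m) s<ℓ =
    ⊥-elim (<⇒≱ (<-trans (+-monoʳ-< A s<ℓ) B<m) (subst (m ≤_) (sym A+s≡U+m) (m≤n+m m U)))

  ⟶-outside : ∀ {A B V s ℓ} → A < B → B ⟶[ ℓ ] A → V ⟶[ suc s ] A → s < ℓ → V < A ⊎ B ≤ V
  ⟶-outside {V = V} {s} _ _ (inj₁ V+s+1≡A) _ = inj₁ (subst (V <_) V+s+1≡A (m<m+n V z<s))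
  ⟶-outside {A} {B} A<B (inj₁ B+ℓ≡A) (inj₂ _) _ = ⊥-elim (<⇒≱ A<B (subst (B ≤_) B+ℓ≡A (m≤m+n B _)))
  ⟶-outside {A} {B} {V} _ (inj₂ B+ℓ≡A+m) (inj₂ V+s+1≡A+m) s<ℓ =
    inj₂ (≮⇒≥ λ V<B → <-irrefl (trans V+s+1≡A+m (sym B+ℓ≡A+m)) (+-mono-<-≤ V<B s<ℓ))

module Charts (m : ℕ) where
  open CycleArithmetic m

  record Chart : Set where
    field
      label            : Fin m → ℕ
      label<m          : ∀ v → label v < m
      label-injective  : ∀ {u v} → label u ≡ label v → u ≡ v
      label-surjective : ∀ {t} → t < m → ∃ λ v → label v ≡ t
      adj⇒AdjMod       : ∀ {u v} → Adj (Cycle m) u v → AdjMod (label u) (label v)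
      SuccMod⇒adj      : ∀ {u v} → SuccMod (label u) (label v) → Adj (Cycle m) u v

  open Chart public

  data Orientation : Set where
    forward backward : Orientation

  -- The forward chart at a is the rotation v ↦ v − a, the backward one the reflection v ↦ a − v.
  chart : Orientation → Fin m → Chart
  chart forward a = record
    { label            = λ v → offset (toℕ a) (toℕ v)
    ; label<m          = λ v → offset<m a<m (toℕ<n v)
    ; label-injective  = λ {u} {v} eq → toℕ-injective (offset-injectiveʳ a<m (toℕ<n u) (toℕ<n v) eq)
    ; label-surjective = surjective
    ; adj⇒AdjMod       = λ { {u} {v} (inj₁ u→v) → inj₁ (offset-succʳ a<m (toℕ<n u) (toℕ<n v) u→v)
                           ; {u} {v} (inj₂ v→u) → inj₂ (offset-succʳ a<m (toℕ<n v) (toℕ<n u) v→u) }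
    ; SuccMod⇒adj      = λ {u} {v} t→t' → inj₁ (offset-succʳ⁻¹ a<m (toℕ<n u) (toℕ<n v) t→t')
    }
    where
    a<m = toℕ<n a
    surjective : ∀ {t} → t < m → ∃ λ v → offset (toℕ a) (toℕ v) ≡ t
    surjective t<m with offset-surjectiveʳ a<m t<m
    ... | v , v<m , eq = fromℕ< v<m , trans (cong (offset (toℕ a)) (toℕ-fromℕ< v<m)) eq
  chart backward a = record
    { label            = λ v → offset (toℕ v) (toℕ a)
    ; label<m          = λ v → offset<m (toℕ<n v) a<m
    ; label-injective  = λ {u} {v} eq → toℕ-injective (offset-injectiveˡ (toℕ<n u) (toℕ<n v) eq)
    ; label-surjective = surjective
    ; adj⇒AdjMod       = λ { {u} {v} (inj₁ u→v) → inj₂ (offset-succˡ a<m (toℕ<n u) (toℕ<n v) u→v)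
                           ; {u} {v} (inj₂ v→u) → inj₁ (offset-succˡ a<m (toℕ<n v) (toℕ<n u) v→u) }
    ; SuccMod⇒adj      = λ {u} {v} s→s' → inj₂ (offset-succˡ⁻¹ a<m (toℕ<n u) (toℕ<n v) s→s')
    }
    where
    a<m = toℕ<n a
    surjective : ∀ {t} → t < m → ∃ λ v → offset (toℕ v) (toℕ a) ≡ t
    surjective t<m with offset-surjectiveˡ a<m t<m
    ... | v , v<m , eq = fromℕ< v<m , trans (cong (λ x → offset x (toℕ a)) (toℕ-fromℕ< v<m)) eq

  label-centre : ∀ o a → label (chart o a) a ≡ 0
  label-centre forward  a = offset-self (toℕ a)
  label-centre backward a = offset-self (toℕ a)

  Sweeps : Chart → ℕ → ℕ → List (Fin m) → Set
  Sweeps C lo hi vs = ∀ s → lo ≤ s → s < hi →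
    ∃ λ u → ∃ λ v → EdgeIn u v vs × label C u ≡ s × label C v ≡ suc s

  -- A simple walk that has just moved up from label t to t + 1 can neither turn back
  -- nor pass label 0, so it keeps moving up.
  climb : ∀ (C : Chart) {a pv c d vs} t → label C a ≡ 0 → label C pv ≡ t → label C c ≡ suc t →
          Chain (Cycle m) c d vs → All (a ≢_) vs → All (pv ≢_) vs → Unique vs →
          label C d ≡ t + length vs × Sweeps C (suc t) (label C d) vs
  climb C t _ _ c↦t+1 single _ _ _ =
    trans c↦t+1 (+-comm 1 t) , λ s t<s s<c → ⊥-elim (<-irrefl refl (≤-<-trans t<s (subst (s <_) c↦t+1 s<c)))
  climb C {a} {pv} {c} {d} t a↦0 pv↦t c↦t+1
        (step {c = c'} {vs = vs'} c~c' chain) (_ ∷ a∉) (_ ∷ pv∉) (c∉ ∷ unique)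
    with adj⇒AdjMod C c~c'
  ... | inj₁ (inj₁ up) = trans length≡ (sym (+-suc t (length vs'))) , sweeps
    where
    c'↦t+2 = trans (sym up) (cong suc c↦t+1)
    IH = climb C (suc t) a↦0 c↦t+1 c'↦t+2 chain a∉ c∉ unique
    length≡ = proj₁ IH
    sweeps : Sweeps C (suc t) (label C d) (c ∷ vs')
    sweeps s t<s s<d with m≤n⇒m<n∨m≡n t<s
    ... | inj₂ refl = c , c' , EdgeIn-chainHead chain , c↦t+1 , c'↦t+2
    ... | inj₁ t+1<s with proj₂ IH s t+1<s s<d
    ...   | u , v , uv∈ , u↦s , v↦s+1 = u , v , there uv∈ , u↦s , v↦s+1
  ... | inj₁ (inj₂ (_ , c'↦0)) = ⊥-elim (All⇒chainHead chain a∉ (label-injective C (trans a↦0 (sym c'↦0))))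
  ... | inj₂ (inj₁ down)       =
    ⊥-elim (All⇒chainHead chain pv∉ (label-injective C (trans pv↦t (sym (suc-injective (trans down c↦t+1))))))
  ... | inj₂ (inj₂ (_ , c↦0))  = ⊥-elim (0≢1+n (trans (sym c↦0) c↦t+1))

  -- The orientation is the direction in which p leaves a.
  path-in-chart : ∀ {a b} → a ≢ b → (p : Path (Cycle m) a b) →
    ∃ λ o → label (chart o a) b ≡ len p × Sweeps (chart o a) 0 (len p) (proj₁ p)
  path-in-chart a≢b (_ , single , _) = ⊥-elim (a≢b refl)
  path-in-chart {a} {b} a≢b (.(a ∷ vs) , step {c = c} {vs = vs} a~c chain , a∉ ∷ unique) = orient a~c
    where
    1<m = distinct⇒1<m a≢b
    climbFrom : ∀ o → label (chart o a) c ≡ 1 →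
      label (chart o a) b ≡ length vs × Sweeps (chart o a) 0 (length vs) (a ∷ vs)
    climbFrom o c↦1 = proj₁ climbed , sweeps
      where
      C = chart o a
      climbed = climb C 0 (label-centre o a) (label-centre o a) c↦1 chain a∉ a∉ unique
      sweeps : Sweeps C 0 (length vs) (a ∷ vs)
      sweeps zero    _ _   = a , c , EdgeIn-chainHead chain , label-centre o a , c↦1
      sweeps (suc s) _ s<ℓ with proj₂ climbed (suc s) (s≤s z≤n) (subst (suc s <_) (sym (proj₁ climbed)) s<ℓ)
      ... | u , v , uv∈ , u↦s , v↦s+1 = u , v , there uv∈ , u↦s , v↦s+1
    orient : Adj (Cycle m) a c →
      ∃ λ o → label (chart o a) b ≡ length vs × Sweeps (chart o a) 0 (length vs) (a ∷ vs)
    orient (inj₁ a→c) = forward  , climbFrom forward  (SuccMod⇒offset≡1 1<m (toℕ<n a) (toℕ<n c) a→c)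
    orient (inj₂ c→a) = backward , climbFrom backward (SuccMod⇒offset≡1 1<m (toℕ<n c) (toℕ<n a) c→a)

  len-path : ∀ {a b} → a ≢ b → (p : Path (Cycle m) a b) →
    len p ≡ offset (toℕ a) (toℕ b) ⊎ len p ≡ offset (toℕ b) (toℕ a)
  len-path a≢b p with path-in-chart a≢b p
  ... | forward  , b↦len , _ = inj₁ (sym b↦len)
  ... | backward , b↦len , _ = inj₂ (sym b↦len)

  module MonotoneWalk (C : Chart) (a : Fin m) where

    -- The vertex labelled t; the default a for t ≥ m is never used.
    vertexAt : ℕ → Fin m
    vertexAt t with t <? m
    ... | yes t<m = proj₁ (label-surjective C t<m)
    ... | no  _   = a

    label-vertexAt : ∀ {t} → t < m → label C (vertexAt t) ≡ t
    label-vertexAt {t} t<m with t <? m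
    ... | yes t<m' = proj₂ (label-surjective C t<m')
    ... | no  t≮m  = ⊥-elim (t≮m t<m)

    walk : ℕ → ℕ → List (Fin m)
    walk t zero    = vertexAt t ∷ []
    walk t (suc k) = vertexAt t ∷ walk (suc t) k

    walk-chain : ∀ t k → t + k < m → Chain (Cycle m) (vertexAt t) (vertexAt (t + k)) (walk t k)
    walk-chain t zero    t<m rewrite +-identityʳ t = single
    walk-chain t (suc k) t+k+1<m rewrite +-suc t k =
      step (SuccMod⇒adj C (inj₁ (trans (cong suc (label-vertexAt t<m)) (sym (label-vertexAt t+1<m)))))
           (walk-chain (suc t) k t+k+1<m)
      where
      t<m   = ≤-<-trans (m≤m+n t (suc k)) (subst (_< m) (sym (+-suc t k)) t+k+1<m)
      t+1<m = ≤-<-trans (s≤s (m≤m+n t k)) t+k+1<m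

    walk-All : ∀ {P : Fin m → Set} t k → (∀ s → t ≤ s → s ≤ t + k → P (vertexAt s)) → All P (walk t k)
    walk-All t zero    P-at = P-at t ≤-refl (m≤m+n t 0) ∷ []
    walk-All t (suc k) P-at =
      P-at t ≤-refl (m≤m+n t (suc k)) ∷
      walk-All (suc t) k (λ s t<s s≤ → P-at s (≤-trans (n≤1+n t) t<s) (subst (s ≤_) (sym (+-suc t k)) s≤))

    walk-unique : ∀ t k → t + k < m → Unique (walk t k)
    walk-unique t zero    _ = [] ∷ []
    walk-unique t (suc k) t+k+1<m =
      walk-All (suc t) k distinct ∷ walk-unique (suc t) k (subst (_< m) (+-suc t k) t+k+1<m)
      where
      <m : ∀ {s} → s ≤ suc t + k → s < m
      <m s≤ = ≤-<-trans s≤ (subst (_< m) (+-suc t k) t+k+1<m)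
      distinct : ∀ s → suc t ≤ s → s ≤ suc t + k → vertexAt t ≢ vertexAt s
      distinct s t<s s≤ eq =
        <-irrefl (trans (sym (label-vertexAt (<m (≤-trans (n≤1+n t) (≤-trans t<s s≤)))))
                        (trans (cong (label C) eq) (label-vertexAt (<m s≤)))) t<s

    walk-edge : ∀ {u v} t k → EdgeIn u v (walk t k) →
      ∃ λ s → s < t + k × u ≡ vertexAt s × v ≡ vertexAt (suc s)
    walk-edge t zero          (there ())
    walk-edge t (suc zero)    here = t , subst (t <_) (sym (+-suc t 0)) (s≤s (m≤m+n t 0)) , refl , refl
    walk-edge t (suc (suc k)) here = t , subst (t <_) (sym (+-suc t (suc k))) (s≤s (m≤m+n t (suc k))) , refl , refl
    walk-edge t (suc k) (there uv∈) with walk-edge (suc t) k uv∈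
    ... | s , s< , u≡ , v≡ = s , subst (s <_) (sym (+-suc t k)) s< , u≡ , v≡

  monotonePath : (C : Chart) {a : Fin m} (b : Fin m) → label C a ≡ 0 → Path (Cycle m) a b
  monotonePath C {a} b a↦0 = walk 0 ℓ , subst₂ (λ x y → Chain (Cycle m) x y (walk 0 ℓ)) start end
    (walk-chain 0 ℓ (label<m C b)) , walk-unique 0 ℓ (label<m C b)
    where
    open MonotoneWalk C a
    ℓ = label C b
    start : vertexAt 0 ≡ a
    start = label-injective C (trans (label-vertexAt (≤-<-trans z≤n (label<m C b))) (sym a↦0))
    end : vertexAt ℓ ≡ b
    end = label-injective C (label-vertexAt (label<m C b))

  monotonePath-edge : ∀ (C : Chart) {a} b (a↦0 : label C a ≡ 0) {u v} →
    EdgeIn u v (proj₁ (monotonePath C b a↦0)) →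
    ∃ λ s → s < label C b × label C u ≡ s × label C v ≡ suc s
  monotonePath-edge C {a} b a↦0 uv∈ with MonotoneWalk.walk-edge C a 0 (label C b) uv∈
  ... | s , s<ℓ , refl , refl =
    s , s<ℓ , label-vertexAt (<-trans s<ℓ (label<m C b)) , label-vertexAt (≤-<-trans s<ℓ (label<m C b))
    where open MonotoneWalk C a

module ArcColouring (n : ℕ) where

  -- The class (i , j), for i < j ≤ n, consists of the arcs between consecutive points of
  -- i < j < i + n + 1 < j + n around the cycle of length 2n + 1; each has length at most n.
  -- arc (i , j) e is the one containing the edge {e, e + 1}, given by its endpoints in increasing order.
  arc : ℕ × ℕ → ℕ → ℕ × ℕ
  arc (i , j) e with e <? i | e <? j | e <? i + suc n | e <? j + n
  ... | yes _ | _     | _     | _     = i , j + n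
  ... | no  _ | yes _ | _     | _     = i , j
  ... | no  _ | no  _ | yes _ | _     = j , i + suc n
  ... | no  _ | no  _ | no  _ | yes _ = i + suc n , j + n
  ... | no  _ | no  _ | no  _ | no  _ = i , j + n

  n<i+1+n : ∀ i → n < i + suc n
  n<i+1+n i = m≤n+m (suc n) i

  i<j⇒i+1+n≤j+n : ∀ {i j} → i < j → i + suc n ≤ j + n
  i<j⇒i+1+n≤j+n {i} {j} i<j = subst (_≤ j + n) (sym (+-suc i n)) (+-monoˡ-≤ n i<j)

  arc₁ : ∀ {i j e} → i ≤ e → e < j → arc (i , j) e ≡ (i , j)
  arc₁ {i} {j} {e} i≤e e<j with e <? i | e <? j
  ... | yes e<i | _       = ⊥-elim (<⇒≱ e<i i≤e)
  ... | no  _   | yes _   = refl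
  ... | no  _   | no  e≮j = ⊥-elim (e≮j e<j)

  arc₂ : ∀ {i j e} → i < j → j ≤ e → e < i + suc n → arc (i , j) e ≡ (j , i + suc n)
  arc₂ {i} {j} {e} i<j j≤e e<i+n+1 with e <? i | e <? j | e <? i + suc n
  ... | yes e<i | _       | _       = ⊥-elim (<⇒≱ (<-trans e<i i<j) j≤e)
  ... | no  _   | yes e<j | _       = ⊥-elim (<⇒≱ e<j j≤e)
  ... | no  _   | no  _   | yes _   = refl
  ... | no  _   | no  _   | no  e≮ = ⊥-elim (e≮ e<i+n+1)

  arc₃ : ∀ {i j e} → j ≤ n → i + suc n ≤ e → e < j + n → arc (i , j) e ≡ (i + suc n , j + n)
  arc₃ {i} {j} {e} j≤n i+n+1≤e e<j+n with e <? i | e <? j | e <? i + suc n | e <? j + n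
  ... | yes e<i | _       | _       | _     = ⊥-elim (<⇒≱ e<i (≤-trans (m≤m+n i (suc n)) i+n+1≤e))
  ... | no  _   | yes e<j | _       | _     = ⊥-elim (<⇒≱ e<j (≤-trans (<⇒≤ (≤-<-trans j≤n (n<i+1+n i))) i+n+1≤e))
  ... | no  _   | no  _   | yes e<  | _     = ⊥-elim (<⇒≱ e< i+n+1≤e)
  ... | no  _   | no  _   | no  _   | yes _ = refl
  ... | no  _   | no  _   | no  _   | no  e≮ = ⊥-elim (e≮ e<j+n)

  arc₄ : ∀ {i j e} → i < j → e < i ⊎ j + n ≤ e → arc (i , j) e ≡ (i , j + n)
  arc₄ {i} {j} {e} _ (inj₁ e<i) with e <? i
  ... | yes _   = refl
  ... | no  e≮i = ⊥-elim (e≮i e<i)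
  arc₄ {i} {j} {e} i<j (inj₂ j+n≤e) with e <? i | e <? j | e <? i + suc n | e <? j + n
  ... | yes e<i | _       | _       | _       = ⊥-elim (<⇒≱ (<-trans e<i i<j) j≤e)
    where j≤e = ≤-trans (m≤m+n j n) j+n≤e
  ... | no  _   | yes e<j | _       | _       = ⊥-elim (<⇒≱ e<j (≤-trans (m≤m+n j n) j+n≤e))
  ... | no  _   | no  _   | yes e<  | _       = ⊥-elim (<⇒≱ e< (≤-trans (i<j⇒i+1+n≤j+n i<j) j+n≤e))
  ... | no  _   | no  _   | no  _   | yes e< = ⊥-elim (<⇒≱ e< j+n≤e)
  ... | no  _   | no  _   | no  _   | no  _  = refl

  -- The edge {e, e + 1} lies on the shorter arc between A < B, which passes through 0 when B − A > n.
  OnShortArc : ℕ → ℕ → ℕ → Set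
  OnShortArc A B e = (B ∸ A ≤ n × A ≤ e × e < B) ⊎ (B ∸ A ≰ n × (e < A ⊎ B ≤ e))

  record Hosts (c : ℕ × ℕ) (A B : ℕ) : Set where
    field
      i<j    : proj₁ c < proj₂ c
      j≤n    : proj₂ c ≤ n
      arc-on : ∀ {e} → OnShortArc A B e → arc c e ≡ (A , B)

  hosts₁ : ∀ {i j} → i < j → j ≤ n → Hosts (i , j) i j
  hosts₁ {i} {j} i<j j≤n = record { i<j = i<j ; j≤n = j≤n ; arc-on = on }
    where
    on : ∀ {e} → OnShortArc i j e → arc (i , j) e ≡ (i , j)
    on (inj₁ (_ , i≤e , e<j)) = arc₁ i≤e e<j
    on (inj₂ (long , _))      = ⊥-elim (long (≤-trans (m∸n≤m j i) j≤n))

  hosts₂ : ∀ {i j} → i < j → j ≤ n → Hosts (i , j) j (i + suc n)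
  hosts₂ {i} {j} i<j j≤n = record { i<j = i<j ; j≤n = j≤n ; arc-on = on }
    where
    on : ∀ {e} → OnShortArc j (i + suc n) e → arc (i , j) e ≡ (j , i + suc n)
    on (inj₁ (_ , j≤e , e<)) = arc₂ i<j j≤e e<
    on (inj₂ (long , _))     =
      ⊥-elim (long (m≤n+o⇒m∸n≤o (i + suc n) j (i<j⇒i+1+n≤j+n i<j)))

  hosts₃ : ∀ {i j} → i < j → j ≤ n → Hosts (i , j) (i + suc n) (j + n)
  hosts₃ {i} {j} i<j j≤n = record { i<j = i<j ; j≤n = j≤n ; arc-on = on }
    where
    on : ∀ {e} → OnShortArc (i + suc n) (j + n) e → arc (i , j) e ≡ (i + suc n , j + n)
    on (inj₁ (_ , ≤e , e<)) = arc₃ j≤n ≤e e<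
    on (inj₂ (long , _))    =
      ⊥-elim (long (m≤n+o⇒m∸n≤o (j + n) (i + suc n) (+-monoˡ-≤ n (<⇒≤ (≤-<-trans j≤n (n<i+1+n i))))))

  hosts₄ : ∀ {i j} → i < j → j ≤ n → Hosts (i , j) i (j + n)
  hosts₄ {i} {j} i<j j≤n = record { i<j = i<j ; j≤n = j≤n ; arc-on = on }
    where
    on : ∀ {e} → OnShortArc i (j + n) e → arc (i , j) e ≡ (i , j + n)
    on (inj₁ (short , _)) =
      ⊥-elim (<⇒≱ i<j (+-cancelʳ-≤ n j i (≤-trans (m≤n+m∸n (j + n) i) (+-monoʳ-≤ i short))))
    on (inj₂ (_ , side))  = arc₄ i<j side

  colour : ℕ → ℕ → ℕ × ℕ
  colour A B with B ≤? n | suc n ≤? A | B ∸ A ≤? n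
  ... | yes _ | _     | _     = A , B
  ... | no  _ | yes _ | _     = A ∸ suc n , B ∸ n
  ... | no  _ | no  _ | yes _ = B ∸ suc n , A
  ... | no  _ | no  _ | no  _ = A , B ∸ n

  colour-hosts : ∀ {A B} → A < B → B ≤ n + n → Hosts (colour A B) A B
  colour-hosts {A} {B} A<B B≤2n with B ≤? n | suc n ≤? A | B ∸ A ≤? n
  ... | yes B≤n | _ | _ = hosts₁ A<B B≤n
  ... | no B≰n | yes n<A | _ =
    subst₂ (Hosts _) (m∸n+n≡m n<A) (m∸n+n≡m n≤B) (hosts₃ i<j (m≤n+o⇒m∸n≤o B n B≤2n))
    where
    n≤B = ≤-trans (n≤1+n n) (≤-trans n<A (<⇒≤ A<B))
    i<j : A ∸ suc n < B ∸ n
    i<j = +-cancelʳ-< n _ _ (begin-strict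
      A ∸ suc n + n       <⟨ +-monoʳ-< (A ∸ suc n) (n<1+n n) ⟩
      A ∸ suc n + suc n   ≡⟨ m∸n+n≡m n<A ⟩
      A                   <⟨ A<B ⟩
      B                   ≡⟨ m∸n+n≡m n≤B ⟨
      B ∸ n + n           ∎)
      where open ≤-Reasoning
  ... | no B≰n | no n≮A | yes short = subst (Hosts _ A) (m∸n+n≡m n<B) (hosts₂ i<A (s≤s⁻¹ (≰⇒> n≮A)))
    where
    n<B = ≰⇒> B≰n
    i<A : B ∸ suc n < A
    i<A = +-cancelʳ-≤ n _ _ (begin
      suc (B ∸ suc n) + n ≡⟨ +-suc (B ∸ suc n) n ⟨
      B ∸ suc n + suc n   ≡⟨ m∸n+n≡m n<B ⟩
      B                   ≤⟨ m≤n+m∸n B A ⟩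
      A + (B ∸ A)         ≤⟨ +-monoʳ-≤ A short ⟩
      A + n               ∎)
      where open ≤-Reasoning
  ... | no B≰n | no _ | no long = subst (Hosts _ A) (m∸n+n≡m n≤B) (hosts₄ A<j (m≤n+o⇒m∸n≤o B n B≤2n))
    where
    n≤B = ≤-trans (n≤1+n n) (≰⇒> B≰n)
    A<j : A < B ∸ n
    A<j = +-cancelʳ-≤ n _ _ (begin
      suc A + n           ≡⟨ +-suc A n ⟨
      A + suc n           ≤⟨ +-monoʳ-≤ A (≰⇒> long) ⟩
      A + (B ∸ A)         ≡⟨ m+[n∸m]≡n (<⇒≤ A<B) ⟩
      B                   ≡⟨ m∸n+n≡m n≤B ⟨
      B ∸ n + n           ∎)
      where open ≤-Reasoning

module ShortestPathPacking (n : ℕ) (1≤n : 1 ≤ n) where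

  m : ℕ
  m = suc (n + n)

  open CycleArithmetic m
  open Charts m
  open ArcColouring n
  open Hosts

  2<m : 2 < m
  2<m = s≤s (+-mono-≤ 1≤n 1≤n)

  EdgeAt : Fin m → Fin m → ℕ → Set
  EdgeAt u v e = (toℕ u ≡ e × SuccMod e (toℕ v)) ⊎ (toℕ v ≡ e × SuccMod e (toℕ u))

  EdgeAt-sym : ∀ {u v e} → EdgeAt u v e → EdgeAt v u e
  EdgeAt-sym (inj₁ at) = inj₂ at
  EdgeAt-sym (inj₂ at) = inj₁ at

  EdgeAt-unique : ∀ {u v e e'} → EdgeAt u v e → EdgeAt u v e' → e ≡ e'
  EdgeAt-unique (inj₁ (refl , _))   (inj₁ (refl , _))    = refl
  EdgeAt-unique (inj₁ (refl , u→v)) (inj₂ (refl , v→u)) = ⊥-elim (SuccMod-asym 2<m u→v v→u)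
  EdgeAt-unique (inj₂ (refl , v→u)) (inj₁ (refl , u→v)) = ⊥-elim (SuccMod-asym 2<m u→v v→u)
  EdgeAt-unique (inj₂ (refl , _))   (inj₂ (refl , _))    = refl

  shortestPath : (a b : Fin m) → Path (Cycle m) a b
  shortestPath a b with toℕ b ∸ toℕ a ≤? n
  ... | yes _ = monotonePath (chart forward a) b (label-centre forward a)
  ... | no  _ = monotonePath (chart backward a) b (label-centre backward a)

  shortestPath-edge : ∀ {a b u v} → toℕ a < toℕ b → EdgeIn u v (proj₁ (shortestPath a b)) →
    ∃ λ e → EdgeAt u v e × OnShortArc (toℕ a) (toℕ b) e
  shortestPath-edge {a} {b} {u} {v} a<b uv∈ with toℕ b ∸ toℕ a ≤? n
  ... | yes short with monotonePath-edge (chart forward a) b (label-centre forward a) uv∈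
  ...   | s , s<ℓ , u↦s , v↦s+1 =
    toℕ u , inj₁ (refl , u→v) ,
    inj₁ (short , ⟶-between (<⇒≤ a<b) (toℕ<n b) (offset<m A<m (toℕ<n b)) (offset-⟶ A<m)
                             (subst (toℕ a ⟶[_] toℕ u) u↦s (offset-⟶ A<m)) s<ℓ)
    where
    A<m = toℕ<n a
    u→v = offset-succʳ⁻¹ A<m (toℕ<n u) (toℕ<n v) (inj₁ (trans (cong suc u↦s) (sym v↦s+1)))
  shortestPath-edge {a} {b} {u} {v} a<b uv∈ | no long
    with monotonePath-edge (chart backward a) b (label-centre backward a) uv∈
  ...   | s , s<ℓ , u↦s , v↦s+1 =
    toℕ v , inj₂ (refl , v→u) ,
    inj₂ (long , ⟶-outside a<b (offset-⟶ (toℕ<n b))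
                              (subst (toℕ v ⟶[_] toℕ a) v↦s+1 (offset-⟶ (toℕ<n v))) s<ℓ)
    where
    v→u = offset-succˡ⁻¹ (toℕ<n a) (toℕ<n u) (toℕ<n v) (inj₁ (trans (cong suc u↦s) (sym v↦s+1)))

  shortestPaths : PathSystem (Cycle m)
  shortestPaths a b _ = shortestPath a b

  hosts : (a b : Fin m) → a F.< b → Hosts (colour (toℕ a) (toℕ b)) (toℕ a) (toℕ b)
  hosts a b a<b = colour-hosts a<b (s≤s⁻¹ (toℕ<n b))

  colourOf : (a b : Fin m) → a F.< b → Fin (triangle n)
  colourOf a b a<b = fromℕ< (pairCode<triangle (i<j (hosts a b a<b)) (j≤n (hosts a b a<b)))

  colourOf-injective : ∀ {a b c d} (a<b : a F.< b) (c<d : c F.< d) → colourOf a b a<b ≡ colourOf c d c<d →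
    colour (toℕ a) (toℕ b) ≡ colour (toℕ c) (toℕ d)
  colourOf-injective {a} {b} {c} {d} a<b c<d eq with pairCode-injective (i<j (hosts a b a<b)) (i<j (hosts c d c<d))
    (trans (sym (toℕ-fromℕ< _)) (trans (cong toℕ eq) (toℕ-fromℕ< _)))
  ... | i≡i' , j≡j' = cong₂ _,_ i≡i' j≡j'

  shortestPath-edge± : ∀ {a b u v} → toℕ a < toℕ b →
    EdgeIn u v (proj₁ (shortestPath a b)) ⊎ EdgeIn v u (proj₁ (shortestPath a b)) →
    ∃ λ e → EdgeAt u v e × OnShortArc (toℕ a) (toℕ b) e
  shortestPath-edge± a<b (inj₁ uv∈) = shortestPath-edge a<b uv∈
  shortestPath-edge± a<b (inj₂ vu∈) = let (e , at , on) = shortestPath-edge a<b vu∈ in e , EdgeAt-sym at , on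

  -- A shared edge lies on a single arc of the common colour class.
  sameColour⇒samePair : ∀ {a b c d} (a<b : a F.< b) (c<d : c F.< d) →
    SharesEdge (shortestPath a b) (shortestPath c d) → colourOf a b a<b ≡ colourOf c d c<d →
    (toℕ a , toℕ b) ≡ (toℕ c , toℕ d)
  sameColour⇒samePair {a} {b} {c} {d} a<b c<d (u , v , uv∈ , uv∈′) same
    with shortestPath-edge a<b uv∈ | shortestPath-edge± c<d uv∈′
  ... | e , at , on | e′ , at′ , on′ = begin
    (toℕ a , toℕ b)                 ≡⟨ arc-on (hosts a b a<b) on ⟨
    arc (colour (toℕ a) (toℕ b)) e  ≡⟨ cong₂ arc (colourOf-injective a<b c<d same) (EdgeAt-unique at at′) ⟩
    arc (colour (toℕ c) (toℕ d)) e′ ≡⟨ arc-on (hosts c d c<d) on′ ⟩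
    (toℕ c , toℕ d)                 ∎
    where open ≡-Reasoning

  shortestPaths-packing : Packing shortestPaths (triangle n)
  shortestPaths-packing = colourOf , proper
    where
    proper : (a b c d : Fin m) (a<b : a F.< b) (c<d : c F.< d) → a ≢ c ⊎ b ≢ d →
      SharesEdge (shortestPath a b) (shortestPath c d) → colourOf a b a<b ≢ colourOf c d c<d
    proper a b c d a<b c<d distinct shared same =
      [ (λ a≢c → a≢c (toℕ-injective (proj₁ AB≡CD)))
      , (λ b≢d → b≢d (toℕ-injective (proj₂ AB≡CD))) ]′ distinct
      where AB≡CD = ,-injective (sameColour⇒samePair a<b c<d shared same)

module TwoEdgeCut (r s : ℕ) where

  m : ℕ
  m = suc (r + s)

  open CycleArithmetic m
  open Charts m

  cutLabel : Fin 2 → ℕ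
  cutLabel F.zero    = 0
  cutLabel (F.suc _) = r

  module _ (C : Chart) where

    -- Only the two cut edges {0, 1} and {r, r + 1} leave the vertices labelled 1, …, r.
    Inside : Fin m → Set
    Inside v = 1 ≤ label C v × label C v ≤ r

    inside? : Decidable Inside
    inside? v = (1 ≤? label C v) ×-dec (label C v ≤? r)

    Traverses : Fin 2 → List (Fin m) → Set
    Traverses τ vs = ∃ λ u → ∃ λ v →
      label C u ≡ cutLabel τ × label C v ≡ suc (cutLabel τ) × (EdgeIn u v vs ⊎ EdgeIn v u vs)

    Traverses⇒SharesEdge : ∀ {τ a b c d} {p : Path (Cycle m) a b} {q : Path (Cycle m) c d} →
      Traverses τ (proj₁ p) → Traverses τ (proj₁ q) → SharesEdge p q
    Traverses⇒SharesEdge (u , v , u↦ , v↦ , uv∈p) (u' , v' , u'↦ , v'↦ , uv∈q)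
      with label-injective C (trans u'↦ (sym u↦)) | label-injective C (trans v'↦ (sym v↦)) | uv∈p
    ... | refl | refl | inj₁ uv∈ = u , v , uv∈ , uv∈q
    ... | refl | refl | inj₂ vu∈ = v , u , vu∈ , swap uv∈q

    leaving-edge : ∀ {u v vs} → r < r + s → Adj (Cycle m) u v → Inside u → ¬ Inside v →
      (EdgeIn u v vs ⊎ EdgeIn v u vs) → ∃ λ τ → Traverses τ vs
    leaving-edge {u} {v} r<r+s u~v (1≤u , u≤r) v-out uv∈ with adj⇒AdjMod C u~v
    ... | inj₁ (inj₁ up) = F.suc F.zero , u , v , u↦r , trans (sym up) (cong suc u↦r) , uv∈
      where
      r<v : r < label C v
      r<v = ≰⇒> λ v≤r → v-out (subst (1 ≤_) up (s≤s z≤n) , v≤r)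
      u↦r : label C u ≡ r
      u↦r = ≤-antisym u≤r (s≤s⁻¹ (subst (r <_) (sym up) r<v))
    ... | inj₁ (inj₂ (up , _)) = ⊥-elim (<⇒≱ r<r+s (subst (_≤ r) (cong pred up) u≤r))
    ... | inj₂ (inj₁ down) = F.zero , v , u , v↦0 , trans (sym down) (cong suc v↦0) , swap uv∈
      where
      v≤r : label C v ≤ r
      v≤r = ≤-trans (n≤1+n _) (subst (_≤ r) (sym down) u≤r)
      v↦0 : label C v ≡ 0
      v↦0 = n≤0⇒n≡0 (s≤s⁻¹ (≰⇒> λ 1≤v → v-out (1≤v , v≤r)))
    ... | inj₂ (inj₂ (_ , u↦0)) = ⊥-elim (<-irrefl (sym u↦0) 1≤u)

    crosses : ∀ {c d vs} → r < r + s → Chain (Cycle m) c d vs →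
      (Inside c × ¬ Inside d) ⊎ (¬ Inside c × Inside d) → ∃ λ τ → Traverses τ vs
    crosses r<r+s chain (inj₁ (c-in , d-out))
      with chain-crossing Inside inside? chain c-in d-out
    ... | u , v , uv∈ , u-in , v-out , u~v = leaving-edge r<r+s u~v u-in v-out (inj₁ uv∈)
    crosses r<r+s chain (inj₂ (c-out , d-in))
      with chain-crossing (λ v → ¬ Inside v) (λ v → ¬? (inside? v)) chain c-out (λ d-out → d-out d-in)
    ... | u , v , uv∈ , u-out , ¬v-out , u~v =
      leaving-edge r<r+s (swap u~v) (decidable-stable (inside? v) ¬v-out) u-out (inj₂ uv∈)

    module CrossingCount {P : PathSystem (Cycle m)} {k : ℕ} (packing : Packing P k)
                 {a b : Fin m} (a<b : a F.< b) (a↦0 : label C a ≡ 0) (r<b : r < label C b)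
                 (sweeps : Sweeps C 0 (label C b) (proj₁ (P a b a<b))) where

      ω = proj₁ packing

      r<r+s : r < r + s
      r<r+s = <-≤-trans r<b (s≤s⁻¹ (label<m C b))

      a-out : ¬ Inside a
      a-out (1≤a , _) = <-irrefl (sym a↦0) 1≤a

      b-out : ¬ Inside b
      b-out (_ , b≤r) = <⇒≱ r<b b≤r

      traverses-both : ∀ τ → Traverses τ (proj₁ (P a b a<b))
      traverses-both τ with sweeps (cutLabel τ) z≤n (cut<b τ)
        where
        cut<b : ∀ τ → cutLabel τ < label C b
        cut<b F.zero    = <-≤-trans (s≤s z≤n) r<b
        cut<b (F.suc _) = r<b
      ... | u , v , uv∈ , u↦ , v↦ = u , v , u↦ , v↦ , inj₁ uv∈

      vertex : ∀ {t} → t < m → Fin m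
      vertex t<m = proj₁ (label-surjective C t<m)

      inner : Fin r → Fin m
      inner x = vertex {suc (toℕ x)} (s≤s (≤-trans (toℕ<n x) (m≤m+n r s)))

      outerLabel : Fin (suc s) → ℕ
      outerLabel F.zero    = 0
      outerLabel (F.suc y) = suc r + toℕ y

      outer : Fin (suc s) → Fin m
      outer y = vertex (outerLabel<m y)
        where
        outerLabel<m : ∀ y → outerLabel y < m
        outerLabel<m F.zero    = z<s
        outerLabel<m (F.suc y) = s≤s (subst (_≤ r + s) (+-suc r (toℕ y)) (+-monoʳ-≤ r (toℕ<n y)))

      inner↦ : ∀ x → label C (inner x) ≡ suc (toℕ x)
      inner↦ x = proj₂ (label-surjective C _)

      outer↦ : ∀ y → label C (outer y) ≡ outerLabel y
      outer↦ y = proj₂ (label-surjective C _)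

      inner-in : ∀ x → Inside (inner x)
      inner-in x = subst (1 ≤_) (sym (inner↦ x)) (s≤s z≤n) , subst (_≤ r) (sym (inner↦ x)) (toℕ<n x)

      outer-out : ∀ y → ¬ Inside (outer y)
      outer-out F.zero    (1≤ , _) = <-irrefl (sym (outer↦ F.zero)) 1≤
      outer-out (F.suc y) (_ , ≤r) = <⇒≱ (s≤s (m≤m+n r (toℕ y))) (subst (_≤ r) (outer↦ (F.suc y)) ≤r)

      inner-injective : ∀ {x x'} → inner x ≡ inner x' → x ≡ x'
      inner-injective {x} {x'} eq =
        toℕ-injective (suc-injective (trans (sym (inner↦ x)) (trans (cong (label C) eq) (inner↦ x'))))

      outer-injective : ∀ {y y'} → outer y ≡ outer y' → y ≡ y'
      outer-injective {y} {y'} eq = outerLabel-injective (trans (sym (outer↦ y)) (trans (cong (label C) eq) (outer↦ y')))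
        where
        outerLabel-injective : ∀ {y y'} → outerLabel y ≡ outerLabel y' → y ≡ y'
        outerLabel-injective {F.zero}  {F.zero}   _  = refl
        outerLabel-injective {F.suc y} {F.suc y'} eq = cong F.suc (toℕ-injective (+-cancelˡ-≡ (suc r) _ _ eq))

      Endpoints : Fin r → Fin (suc s) → Fin m → Fin m → Set
      Endpoints x y c d = (c ≡ inner x × d ≡ outer y) ⊎ (c ≡ outer y × d ≡ inner x)

      record Crossing (x : Fin r) (y : Fin (suc s)) : Set where
        field
          c d       : Fin m
          c<d       : c F.< d
          endpoints : Endpoints x y c d
          cutEdge   : Fin 2
          traverses : Traverses cutEdge (proj₁ (P c d c<d))

      inner≢outer : ∀ {x y} → inner x ≢ outer y
      inner≢outer {x} {y} eq = outer-out y (subst Inside eq (inner-in x))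

      endpoints-injective : ∀ {x y x' y' c d c' d'} → c ≡ c' → d ≡ d' →
        Endpoints x y c d → Endpoints x' y' c' d' → x ≡ x' × y ≡ y'
      endpoints-injective refl refl (inj₁ (refl , refl)) (inj₁ (e , e')) = inner-injective e , outer-injective e'
      endpoints-injective refl refl (inj₁ (refl , refl)) (inj₂ (e , _))  = ⊥-elim (inner≢outer e)
      endpoints-injective refl refl (inj₂ (refl , refl)) (inj₁ (e , _))  = ⊥-elim (inner≢outer (sym e))
      endpoints-injective refl refl (inj₂ (refl , refl)) (inj₂ (e , e')) = inner-injective e' , outer-injective e

      separated : ∀ {x y c d} → Endpoints x y c d →
        (Inside c × ¬ Inside d) ⊎ (¬ Inside c × Inside d)
      separated {x} {y} (inj₁ (refl , refl)) = inj₁ (inner-in x , outer-out y)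
      separated {x} {y} (inj₂ (refl , refl)) = inj₂ (outer-out y , inner-in x)

      crossing : ∀ x y → Crossing x y
      crossing x y with sortPair (inner x) (outer y) inner≢outer
      ... | c , d , c<d , endpoints = record
        { c = c ; d = d ; c<d = c<d ; endpoints = endpoints
        ; cutEdge = proj₁ traversal ; traverses = proj₂ traversal }
        where traversal = crosses r<r+s (proj₁ (proj₂ (P c d c<d))) (separated endpoints)

      Item : Set
      Item = Fin 2 ⊎ (Fin r × Fin (suc s))

      -- Paths traversing the same cut edge get distinct colours, so (cut edge, colour) tells them apart.
      token : Item → Fin 2 × Fin k
      token (inj₁ τ)       = τ , ω a b a<b
      token (inj₂ (x , y)) = cutEdge , ω c d c<d
        where open Crossing (crossing x y)

      same-token⇒same-pair : ∀ {τ τ' c d c' d'} (c<d : c F.< d) (c'<d' : c' F.< d') →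
        Traverses τ (proj₁ (P c d c<d)) → Traverses τ' (proj₁ (P c' d' c'<d')) →
        (τ , ω c d c<d) ≡ (τ' , ω c' d' c'<d') → c ≡ c' × d ≡ d'
      same-token⇒same-pair c<d c'<d' t t' eq with ,-injective eq
      ... | refl , same-colour = Packing-sharedEdge⇒samePair {P = P} packing c<d c'<d'
                                   (Traverses⇒SharesEdge {p = P _ _ c<d} {q = P _ _ c'<d'} t t') same-colour

      ab-not-endpoints : ∀ {x y} → ¬ Endpoints x y a b
      ab-not-endpoints {x} (inj₁ (a≡inner , _)) = a-out (subst Inside (sym a≡inner) (inner-in x))
      ab-not-endpoints {x} (inj₂ (_ , b≡inner)) = b-out (subst Inside (sym b≡inner) (inner-in x))

      ab-uncrossed : ∀ τ x y → token (inj₁ τ) ≢ token (inj₂ (x , y))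
      ab-uncrossed τ x y eq = ab-not-endpoints (subst₂ (Endpoints x y) (sym a≡c) (sym b≡d) endpoints)
        where
        open Crossing (crossing x y)
        same = same-token⇒same-pair a<b c<d (traverses-both τ) traverses eq
        a≡c = proj₁ same
        b≡d = proj₂ same

      crossing-injective : ∀ {x y x' y'} → token (inj₂ (x , y)) ≡ token (inj₂ (x' , y')) → x ≡ x' × y ≡ y'
      crossing-injective {x} {y} {x'} {y'} eq = endpoints-injective (proj₁ same) (proj₂ same) (endpoints X) (endpoints X')
        where
        open Crossing
        X  = crossing x y
        X' = crossing x' y'
        same = same-token⇒same-pair (c<d X) (c<d X') (traverses X) (traverses X') eq

      token-injective : ∀ {i j} → token i ≡ token j → i ≡ j
      token-injective {inj₁ τ}       {inj₁ τ'}        eq = cong inj₁ (proj₁ (,-injective eq))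
      token-injective {inj₁ τ}       {inj₂ (x , y)}   eq = ⊥-elim (ab-uncrossed τ x y eq)
      token-injective {inj₂ (x , y)} {inj₁ τ}         eq = ⊥-elim (ab-uncrossed τ x y (sym eq))
      token-injective {inj₂ (x , y)} {inj₂ (x' , y')} eq with crossing-injective eq
      ... | refl , refl = refl

      crossing-bound : 2 + r * suc s ≤ 2 * k
      crossing-bound =
        injective⇒≤ (Injection.injective (↔⇒↣ (↔-sym *↔×) ↣-∘ (mk↣ token-injective ↣-∘ enumerate)))
        where
        enumerate : Fin (2 + r * suc s) ↣ Item
        enumerate = (↣-id (Fin 2) ⊎-↣ ↔⇒↣ *↔×) ↣-∘ ↔⇒↣ +↔⊎

module OddCycle (n : ℕ) (1≤n : 1 ≤ n) where

  m : ℕ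
  m = suc (n + n)

  open CycleArithmetic m
  open Charts m

  nonShortest⇒long : ∀ {a b} → a ≢ b → (p q : Path (Cycle m) a b) → len q < len p → n < len p
  nonShortest⇒long {a} {b} a≢b p q =
    larger-of-complements (offset+offset≡m (toℕ<n a) (toℕ<n b) (a≢b ∘ toℕ-injective))
      (len-path a≢b p) (len-path a≢b q)

  ideal⇒shortest : (P : PathSystem (Cycle m)) → Ideal P → ∀ a b (a<b : a F.< b) → Shortest (P a b a<b)
  ideal⇒shortest P (k , (packing , _) , (_ , minimal)) a b a<b q = ≮⇒≥ λ q<p → <⇒≱ (cut-bound q<p) colours
    where
    open ShortestPathPacking n 1≤n using (shortestPaths; shortestPaths-packing)
    p = P a b a<b
    a≢b : a ≢ b
    a≢b a≡b = <-irrefl (cong toℕ a≡b) a<b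
    colours : 2 * k ≤ n * suc n
    colours = begin
      2 * k                        ≤⟨ *-monoʳ-≤ 2 (minimal shortestPaths (triangle n) shortestPaths-packing) ⟩
      2 * triangle n               ≡⟨ cong (triangle n +_) (+-identityʳ (triangle n)) ⟩
      triangle n + triangle n      ≡⟨ triangle-double n ⟩
      n * suc n                    ∎
      where open ≤-Reasoning
    cut-bound : len q < len p → n * suc n < 2 * k
    cut-bound q<p with path-in-chart a≢b p
    ... | o , b↦len , sweeps =
      ≤-trans (n≤1+n _) (CrossingCount.crossing-bound packing a<b (label-centre o a) n<b sweeps′)
      where
      module CrossingCount = TwoEdgeCut.CrossingCount n n (chart o a) {P = P}
      n<b = subst (n <_) (sym b↦len) (nonShortest⇒long a≢b p q q<p)
      sweeps′ = subst (λ ℓ → Sweeps (chart o a) 0 ℓ (proj₁ p)) (sym b↦len) sweeps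

2*n+1≡1+n+n : ∀ n → 2 * n + 1 ≡ suc (n + n)
2*n+1≡1+n+n = solve-∀

corollary2 : (n : ℕ) → 1 ≤ n → (P : PathSystem (Cycle (2 * n + 1))) →
    Ideal P → Perfect P
corollary2 n 1≤n rewrite 2*n+1≡1+n+n n = λ P ideal → ideal , OddCycle.ideal⇒shortest n 1≤n P ideal
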